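{- Let $i$ and $j$ be positive integers, let $D$ be an $\langle i,j\rangle$ digraph and let $G$ be its competition graph. If $D$ has no subdigraph $D'$ which is a $\langle\bar 2,\bar 2\rangle$ digraph such that (i) $D'$ is irredundant, (ii) $D'$ does not induce a triangle, and (iii) $D'$ has at least one arc, then $G$ is chordal.
   Context: All digraphs are finite, without loops and without parallel arcs; all graphs are finite and simple. The competition graph of a digraph $D$ has vertex set $V(D)$ and an edge $uv$ ($u\ne v$) iff $u$ and $v$ have a common out-neighbor in $D$. For positive integers $i,j$, an $\langle i,j\rangle$ digraph is a loopless digraph in which every vertex has indegree at most $i$ and outdegree at most $j$ (not necessarily acyclic). A $\langle\bar 2,\bar 2\rangle$ digraph is a loopless digraph in which every vertex has indegree $0$ or $2$ and outdegree $0$ or $2$. A digraph is irredundant if it has no (not necessarily induced) subdigraph isomorphic to $P(2,2)$, the digraph on four distinct vertices $u,v,x,y$ with arcs $(u,x),(u,y),(v,x),(v,y)$. A digraph $D$ induces a triangle if it has a (not necessarily induced) subdigraph isomorphic to one of the following five digraphs: (a) vertices $u_1,u_2,u_3,v_1,v_2,v_3$ with arcs $(u_1,v_1),(u_1,v_3),(u_2,v_1),(u_2,v_2),(u_3,v_2),(u_3,v_3)$; (b) vertices $u_1,u_2,u_3,v_1$ with arcs $(u_1,v_1),(u_2,v_1),(u_3,v_1)$; (c) vertices $u_1,u_2,u_3,v_1,v_3$ with arcs $(u_1,v_1),(u_1,u_2),(u_2,v_1),(u_2,v_3),(u_3,u_2),(u_3,v_3)$; (d) vertices $u_1,u_2,u_3$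 with all six arcs $(u_a,u_b)$, $a\ne b$; (e) vertices $u_1,u_2,v_1,v_2$ with arcs $(u_1,u_2),(u_2,u_1),(u_1,v_1),(u_2,v_1),(v_2,u_1),(v_2,u_2)$. A graph is chordal if it has no induced cycle of length at least $4$. -}

module Defs where

open import Data.Nat using (ℕ; zero; suc; _≤_; _%_)
open import Data.Fin using (Fin; toℕ)
open import Data.Fin.Patterns using (0F; 1F; 2F; 3F; 4F; 5F)
open import Data.Bool using (Bool; true; false)
open import Data.List using (List; []; _∷_; length; filter; allFin)
open import Data.List.Membership.Propositional using (_∈_)
open import Data.Product using (Σ; ∃; _×_; _,_)
open import Data.Sum using (_⊎_)
open import Data.Empty using (⊥)
open import Relation.Nullary using (¬_)
open import Relation.Binary.PropositionalEquality using (_≡_; _≢_)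
open import Data.Bool.Properties using (_≟_)
open import Function using (_⇔_)
open import Function.Definitions using (Injective)

record Digraph : Set where
  field
    n   : ℕ
    arc : Fin n → Fin n → Bool
    loopless : ∀ v → arc v v ≡ false
open Digraph public

Arc : (D : Digraph) → Fin (n D) → Fin (n D) → Set
Arc D u v = arc D u v ≡ true

indeg : (D : Digraph) → Fin (n D) → ℕ
indeg D v = length (filter (λ u → arc D u v ≟ true) (allFin (n D)))

outdeg : (D : Digraph) → Fin (n D) → ℕ
outdeg D u = length (filter (λ v → arc D u v ≟ true) (allFin (n D)))

IJDigraph : ℕ → ℕ → Digraph → Set
IJDigraph i j D = ∀ v → indeg D v ≤ i × outdeg D v ≤ j

Bar22 : Digraph → Set
Bar22 D = ∀ v → (indeg D v ≡ 0 ⊎ indeg D v ≡ 2) × (outdeg D v ≡ 0 ⊎ outdeg D v ≡ 2)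

-- D' is (isomorphic to) a (not necessarily induced) subdigraph of D:
-- an injective vertex map sending arcs to arcs.
_⊑_ : Digraph → Digraph → Set
D' ⊑ D = Σ (Fin (n D') → Fin (n D)) λ f →
  Injective _≡_ _≡_ f × (∀ u v → Arc D' u v → Arc D (f u) (f v))

record Pattern : Set where
  field
    pn   : ℕ
    arcs : List (Fin pn × Fin pn)
open Pattern public

Contains : Digraph → Pattern → Set
Contains D P = Σ (Fin (pn P) → Fin (n D)) λ f →
  Injective _≡_ _≡_ f × (∀ {a b} → (a , b) ∈ arcs P → Arc D (f a) (f b))

-- P(2,2): u=0,v=1,x=2,y=3
P22 : Pattern
P22 = record { pn = 4 ; arcs = (0F , 2F) ∷ (0F , 3F) ∷ (1F , 2F) ∷ (1F , 3F) ∷ [] }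

Irredundant : Digraph → Set
Irredundant D = ¬ Contains D P22

-- triangle-inducing patterns
-- (a) u1=0,u2=1,u3=2,v1=3,v2=4,v3=5
TriA : Pattern
TriA = record { pn = 6 ; arcs = (0F , 3F) ∷ (0F , 5F) ∷ (1F , 3F) ∷ (1F , 4F) ∷ (2F , 4F) ∷ (2F , 5F) ∷ [] }
-- (b) u1=0,u2=1,u3=2,v1=3
TriB : Pattern
TriB = record { pn = 4 ; arcs = (0F , 3F) ∷ (1F , 3F) ∷ (2F , 3F) ∷ [] }
-- (c) u1=0,u2=1,u3=2,v1=3,v3=4
TriC : Pattern
TriC = record { pn = 5 ; arcs = (0F , 3F) ∷ (0F , 1F) ∷ (1F , 3F) ∷ (1F , 4F) ∷ (2F , 1F) ∷ (2F , 4F) ∷ [] }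
-- (d) u1=0,u2=1,u3=2
TriD : Pattern
TriD = record { pn = 3 ; arcs = (0F , 1F) ∷ (0F , 2F) ∷ (1F , 0F) ∷ (1F , 2F) ∷ (2F , 0F) ∷ (2F , 1F) ∷ [] }
-- (e) u1=0,u2=1,v1=2,v2=3
TriE : Pattern
TriE = record { pn = 4 ; arcs = (0F , 1F) ∷ (1F , 0F) ∷ (0F , 2F) ∷ (1F , 2F) ∷ (3F , 0F) ∷ (3F , 1F) ∷ [] }

InducesTriangle : Digraph → Set
InducesTriangle D = Contains D TriA ⊎ Contains D TriB ⊎ Contains D TriC ⊎ Contains D TriD ⊎ Contains D TriE

HasArc : Digraph → Set
HasArc D = ∃ λ u → ∃ λ v → Arc D u v

CompEdge : (D : Digraph) → Fin (n D) → Fin (n D) → Set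
CompEdge D u v = u ≢ v × ∃ λ w → Arc D u w × Arc D v w

CycleAdj : (k : ℕ) → Fin k → Fin k → Set
CycleAdj (suc k) a b = toℕ b ≡ suc (toℕ a) % suc k ⊎ toℕ a ≡ suc (toℕ b) % suc k
CycleAdj zero () _

Chordal : (m : ℕ) → (Fin m → Fin m → Set) → Set
Chordal m E = ∀ (k : ℕ) → 4 ≤ k → ¬ (Σ (Fin k → Fin m) λ c →
  Injective _≡_ _≡_ c × (∀ a b → a ≢ b → (E (c a) (c b) ⇔ CycleAdj k a b)))

CompetitionGraphChordal : Digraph → Set
CompetitionGraphChordal D = Chordal (n D) (CompEdge D)

-- Take an induced cycle c₀ c₁ … c₍ₖ₋₁₎ of length k ≥ 4 in the competition graph
-- and, for each a, a common prey wₐ of cₐ and cₐ₊₁.  If wₐ = w_b with a ≠ b, then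
-- cₐ and c_b compete, so b = a ± 1, and then cₐ, cₐ₊₁, cₐ₊₂ share a prey, giving a
-- chord; hence the wₐ are distinct.  The subdigraph with arcs cₐ → wₐ ← cₐ₊₁ is then
-- a ⟨2̄,2̄⟩ digraph with arcs.  Two distinct vertices compete in it only if they are
-- cₐ, cₐ₊₁ and their common prey is wₐ; so no two of them share two prey
-- (irredundance), and three pairwise competing vertices would be three pairwise
-- consecutive vertices of a cycle of length at least 4 (no induced triangle).
module Submission where

open import Data.Bool using (Bool; true)
open import Data.Bool.Properties using () renaming (_≟_ to _≟ᵇ_)
open import Data.Empty using (⊥; ⊥-elim)
open import Data.Fin using (Fin; zero; suc; toℕ; _≟_)
open import Data.Fin.Patterns using (0F; 1F; 2F; 3F; 4F; 5F)
open import Data.Fin.Properties using (toℕ<n; toℕ-fromℕ<; toℕ-injective; 0≢1+n; suc-injective; any?)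
open import Data.List using (List; length; filter; tabulate)
open import Data.List.Properties using (filter-none; filter-accept; filter-reject)
open import Data.List.Relation.Unary.All.Properties using (tabulate⁺)
open import Data.List.Membership.Propositional using (_∈_)
import Data.List.Membership.DecPropositional as DecMembership
open import Data.Nat using (ℕ; suc; _+_; _*_; _≤_; _<_; z≤n; s≤s; _%_; _/_; NonZero)
open import Data.Nat.Properties using (+-suc; +-identityʳ; +-cancelˡ-≡; ≤-trans; <⇒≱)
open import Data.Nat.DivMod using (_mod_; m≡m%n+[m/n]*n; m%n%n≡m%n; %-distribˡ-+; [m+n]%n≡m%n; m<n⇒m%n≡m)
open import Data.Nat.Divisibility using (_∣_; divides; ∣⇒≤)
open import Data.Nat.GeneralisedArithmetic using (fold; iterate; iterate-is-fold)
open import Data.Product using (Σ; ∃; ∃₂; _×_; _,_; proj₁; proj₂)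
open import Data.Product.Properties using (≡-dec)
open import Data.Sum using (_⊎_; inj₁; inj₂; [_,_]; swap) renaming (map to map-⊎)
open import Function using (_∘_; _⇔_; id; case_of_)
open import Function.Bundles using (Equivalence)
open import Function.Definitions using (Injective)
open import Relation.Binary.PropositionalEquality using (_≡_; _≢_; refl; sym; trans; cong; subst; module ≡-Reasoning)
open import Relation.Nullary using (¬_; Dec; yes; no; does; proof; Reflects; invert)
open import Relation.Nullary.Decidable using (True; False; toWitness; toWitnessFalse; dec-true; dec-false; _⊎-dec_; _×-dec_)
open import Level using (0ℓ)
open import Relation.Binary using (Rel; Decidable)
open import Defs

[m+n]%d≡m⇒d∣n : ∀ m n d .{{_ : NonZero d}} → (m + n) % d ≡ m → d ∣ n
[m+n]%d≡m⇒d∣n m n d eq = divides ((m + n) / d) (+-cancelˡ-≡ m n _ (begin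
  m + n                          ≡⟨ m≡m%n+[m/n]*n (m + n) d ⟩
  (m + n) % d + (m + n) / d * d  ≡⟨ cong (_+ (m + n) / d * d) eq ⟩
  m + (m + n) / d * d            ∎))
  where open ≡-Reasoning

[1+m%n]%n≡[1+m]%n : ∀ m n .{{_ : NonZero n}} → suc (m % n) % n ≡ suc m % n
[1+m%n]%n≡[1+m]%n m n = begin
  (1 + m % n) % n          ≡⟨ %-distribˡ-+ 1 (m % n) n ⟩
  (1 % n + m % n % n) % n  ≡⟨ cong (λ r → (1 % n + r) % n) (m%n%n≡m%n m n) ⟩
  (1 % n + m % n) % n      ≡⟨ %-distribˡ-+ 1 m n ⟨
  (1 + m) % n              ∎
  where open ≡-Reasoning

module _ {A : Set} (p : A → Bool) where

  private
    p? : (x : A) → Dec (p x ≡ true)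
    p? x = p x ≟ᵇ true

  -- indeg D v and outdeg D v unfold to countTrue … id, since allFin n = tabulate id.
  countTrue : ∀ {m} → (Fin m → A) → ℕ
  countTrue g = length (filter p? (tabulate g))

  countTrue-none : ∀ {m} (g : Fin m → A) → (∀ i → p (g i) ≢ true) → countTrue g ≡ 0
  countTrue-none g none = cong length (filter-none p? (tabulate⁺ none))

  countTrue-one : ∀ {m} (g : Fin m → A) i → p (g i) ≡ true →
                  (∀ j → p (g j) ≡ true → j ≡ i) → countTrue g ≡ 1
  countTrue-one g zero    hit only = trans (cong length (filter-accept p? hit))
    (cong suc (countTrue-none (g ∘ suc) λ j e → 0≢1+n (sym (only (suc j) e))))
  countTrue-one g (suc i) hit only = trans (cong length (filter-reject p? (0≢1+n ∘ only zero)))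
    (countTrue-one (g ∘ suc) i hit (λ j e → suc-injective (only (suc j) e)))

  countTrue-two : ∀ {m} (g : Fin m → A) i i′ → i ≢ i′ → p (g i) ≡ true → p (g i′) ≡ true →
                  (∀ j → p (g j) ≡ true → j ≡ i ⊎ j ≡ i′) → countTrue g ≡ 2
  countTrue-two g zero zero i≢i′ _ _ _ = ⊥-elim (i≢i′ refl)
  countTrue-two g zero (suc i′) _ hit hit′ only =
    trans (cong length (filter-accept p? hit))
      (cong suc (countTrue-one (g ∘ suc) i′ hit′ λ j e →
        [ (λ ()) , suc-injective ] (only (suc j) e)))
  countTrue-two g (suc i) zero i≢i′ hit hit′ only =
    countTrue-two g zero (suc i) (i≢i′ ∘ sym) hit′ hit (λ j e → swap (only j e))
  countTrue-two g (suc i) (suc i′) i≢i′ hit hit′ only =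
    trans (cong length (filter-reject p? ([ 0≢1+n , 0≢1+n ] ∘ only zero)))
      (countTrue-two (g ∘ suc) i i′ (i≢i′ ∘ cong suc) hit hit′ λ j e →
        map-⊎ suc-injective suc-injective (only (suc j) e))

module SpanningSubdigraph (D : Digraph) {R : Rel (Fin (n D)) 0ℓ} (R? : Decidable R)
                          (R⇒arc : ∀ {x y} → R x y → Arc D x y) where

  spanned : Digraph
  spanned = record
    { n        = n D
    ; arc      = λ x y → does (R? x y)
    ; loopless = λ x → dec-false (R? x x) λ r →
        case trans (sym (R⇒arc r)) (loopless D x) of λ ()
    }

  arc⇒R : ∀ {x y} → Arc spanned x y → R x y
  arc⇒R {x} {y} e = invert (subst (Reflects (R x y)) e (proof (R? x y)))

  R⇒arc-spanned : ∀ {x y} → R x y → Arc spanned x y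
  R⇒arc-spanned {x} {y} = dec-true (R? x y)

  spanned⊑ : spanned ⊑ D
  spanned⊑ = id , id , λ _ _ → R⇒arc ∘ arc⇒R

_∈ᵃ?_ : ∀ {m} (ab : Fin m × Fin m) (xs : List (Fin m × Fin m)) → Dec (ab ∈ xs)
_∈ᵃ?_ = DecMembership._∈?_ (≡-dec _≟_ _≟_)

-- On a concrete pattern the membership and distinctness side conditions below
-- evaluate to ⊤, so they are filled in automatically.
module Embedding (D : Digraph) (P : Pattern) (emb : Contains D P) where

  embedded-arc : ∀ a b → {True ((a , b) ∈ᵃ? arcs P)} → Arc D (proj₁ emb a) (proj₁ emb b)
  embedded-arc a b {ab∈P} = proj₂ (proj₂ emb) (toWitness ab∈P)

  embedded-competition : ∀ a b z → {False (a ≟ b)} → {True ((a , z) ∈ᵃ? arcs P)} →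
                         {True ((b , z) ∈ᵃ? arcs P)} → CompEdge D (proj₁ emb a) (proj₁ emb b)
  embedded-competition a b z {a≢b} {az} {bz} =
    toWitnessFalse a≢b ∘ proj₁ (proj₂ emb) , proj₁ emb z , embedded-arc a z {az} , embedded-arc b z {bz}

module Cycle (k : ℕ) where

  opaque
    next : Fin (suc k) → Fin (suc k)
    next a = suc (toℕ a) mod suc k

    toℕ-next : ∀ a → toℕ (next a) ≡ suc (toℕ a) % suc k
    toℕ-next a = toℕ-fromℕ< _

  -- next has period suc k, so k steps forward are one step back.
  prev : Fin (suc k) → Fin (suc k)
  prev b = fold b next k

  Consecutive : Rel (Fin (suc k)) 0ℓ
  Consecutive a b = b ≡ next a ⊎ a ≡ next b

  toℕ-fold-next : ∀ j a → toℕ (fold a next j) ≡ (toℕ a + j) % suc k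
  toℕ-fold-next 0 a = sym (trans (cong (_% suc k) (+-identityʳ (toℕ a))) (m<n⇒m%n≡m (toℕ<n a)))
  toℕ-fold-next (suc j) a = begin
    toℕ (next (fold a next j))         ≡⟨ toℕ-next (fold a next j) ⟩
    suc (toℕ (fold a next j)) % suc k  ≡⟨ cong (λ r → suc r % suc k) (toℕ-fold-next j a) ⟩
    suc ((toℕ a + j) % suc k) % suc k  ≡⟨ [1+m%n]%n≡[1+m]%n (toℕ a + j) (suc k) ⟩
    suc (toℕ a + j) % suc k            ≡⟨ cong (_% suc k) (+-suc (toℕ a) j) ⟨
    (toℕ a + suc j) % suc k            ∎
    where open ≡-Reasoning

  fold-next-period : ∀ a → fold a next (suc k) ≡ a
  fold-next-period a = toℕ-injective (begin
    toℕ (fold a next (suc k))  ≡⟨ toℕ-fold-next (suc k) a ⟩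
    (toℕ a + suc k) % suc k    ≡⟨ [m+n]%n≡m%n (toℕ a) (suc k) ⟩
    toℕ a % suc k              ≡⟨ m<n⇒m%n≡m (toℕ<n a) ⟩
    toℕ a                      ∎)
    where open ≡-Reasoning

  fold-next-aperiodic : ∀ {j} a → j < k → fold a next (suc j) ≢ a
  fold-next-aperiodic {j} a j<k eq = <⇒≱ (s≤s j<k) (∣⇒≤ (
    [m+n]%d≡m⇒d∣n (toℕ a) (suc j) (suc k) (trans (sym (toℕ-fold-next (suc j) a)) (cong toℕ eq))))

  next-prev : ∀ b → next (prev b) ≡ b
  next-prev = fold-next-period

  prev-next : ∀ a → prev (next a) ≡ a
  prev-next a = begin
    fold (next a) next k     ≡⟨ iterate-is-fold (next a) next k ⟩
    iterate next (next a) k  ≡⟨ iterate-is-fold a next (suc k) ⟨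
    fold a next (suc k)      ≡⟨ fold-next-period a ⟩
    a                        ∎
    where open ≡-Reasoning

  next-injective : Injective _≡_ _≡_ next
  next-injective {a} {b} eq = trans (sym (prev-next a)) (trans (cong prev eq) (prev-next b))

  cycleAdj-next : ∀ a → CycleAdj (suc k) a (next a)
  cycleAdj-next a = inj₁ (toℕ-next a)

  cycleAdj⇒consecutive : ∀ {a b} → CycleAdj (suc k) a b → Consecutive a b
  cycleAdj⇒consecutive {a} {b} = map-⊎ (λ e → toℕ-injective (trans e (sym (toℕ-next a))))
                                       (λ e → toℕ-injective (trans e (sym (toℕ-next b))))

  module LengthAtLeastFour (k≥3 : 3 ≤ k) where

    next≢ : ∀ a → next a ≢ a
    next≢ a = fold-next-aperiodic a (≤-trans (s≤s z≤n) k≥3)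

    next²≢ : ∀ a → next (next a) ≢ a
    next²≢ a = fold-next-aperiodic a (≤-trans (s≤s (s≤s z≤n)) k≥3)

    next³≢ : ∀ a → next (next (next a)) ≢ a
    next³≢ a = fold-next-aperiodic a k≥3

    consecutive-triangle-free : ∀ {a b d} → Consecutive a b → Consecutive b d → Consecutive a d → ⊥
    consecutive-triangle-free {a} (inj₁ refl) (inj₁ refl) (inj₁ e) = next≢ (next a) e
    consecutive-triangle-free {a} (inj₁ refl) (inj₁ refl) (inj₂ e) = next³≢ a (sym e)
    consecutive-triangle-free {d = d} (inj₁ refl) (inj₂ e′) (inj₁ e) =
      next≢ d (sym (trans e (cong next (next-injective e′))))
    consecutive-triangle-free {a} (inj₁ refl) (inj₂ e′) (inj₂ e) = next≢ a (sym (trans e (sym e′)))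
    consecutive-triangle-free {b = b} (inj₂ refl) (inj₁ refl) (inj₁ e) = next≢ (next b) (sym e)
    consecutive-triangle-free {b = b} (inj₂ refl) (inj₁ refl) (inj₂ e) = next≢ (next b) (sym e)
    consecutive-triangle-free {d = d} (inj₂ refl) (inj₂ refl) (inj₁ e) = next³≢ d (sym e)
    consecutive-triangle-free {d = d} (inj₂ refl) (inj₂ refl) (inj₂ e) = next≢ (next d) e

module InducedCycle (D : Digraph) {k : ℕ} (k≥3 : 3 ≤ k)
  (c : Fin (suc k) → Fin (n D)) (c-injective : Injective _≡_ _≡_ c)
  (c-induced : ∀ a b → a ≢ b → (CompEdge D (c a) (c b) ⇔ CycleAdj (suc k) a b)) where

  open Cycle k
  open LengthAtLeastFour k≥3

  competes-next : ∀ a → CompEdge D (c a) (c (next a))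
  competes-next a = Equivalence.from (c-induced a (next a) (next≢ a ∘ sym)) (cycleAdj-next a)

  opaque
    prey : Fin (suc k) → Fin (n D)
    prey a = proj₁ (proj₂ (competes-next a))

    prey-left : ∀ a → Arc D (c a) (prey a)
    prey-left a = proj₁ (proj₂ (proj₂ (competes-next a)))

    prey-right : ∀ a → Arc D (c (next a)) (prey a)
    prey-right a = proj₂ (proj₂ (proj₂ (competes-next a)))

  common-prey⇒consecutive : ∀ {a b z} → a ≢ b → Arc D (c a) z → Arc D (c b) z → Consecutive a b
  common-prey⇒consecutive {a} {b} {z} a≢b ha hb =
    cycleAdj⇒consecutive (Equivalence.to (c-induced a b a≢b) (a≢b ∘ c-injective , z , ha , hb))

  prey≢prey-next : ∀ a → prey a ≢ prey (next a)
  prey≢prey-next a eq = [ next≢ (next a) , next³≢ a ∘ sym ]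
    (common-prey⇒consecutive (next²≢ a ∘ sym) (prey-left a)
      (subst (Arc D (c (next (next a)))) (sym eq) (prey-right (next a))))

  prey-injective : Injective _≡_ _≡_ prey
  prey-injective {a} {b} eq with a ≟ b
  ... | yes a≡b = a≡b
  ... | no a≢b with common-prey⇒consecutive a≢b (prey-left a) (subst (Arc D (c b)) (sym eq) (prey-left b))
  ...   | inj₁ refl = ⊥-elim (prey≢prey-next a eq)
  ...   | inj₂ refl = ⊥-elim (prey≢prey-next b (sym eq))

  Hunts : Rel (Fin (n D)) 0ℓ
  Hunts x y = ∃ λ a → (x ≡ c a ⊎ x ≡ c (next a)) × y ≡ prey a

  opaque
    hunts? : Decidable Hunts
    hunts? x y = any? λ a → ((x ≟ c a) ⊎-dec (x ≟ c (next a))) ×-dec (y ≟ prey a)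

  hunts⇒arc : ∀ {x y} → Hunts x y → Arc D x y
  hunts⇒arc (a , inj₁ refl , refl) = prey-left a
  hunts⇒arc (a , inj₂ refl , refl) = prey-right a

  open SpanningSubdigraph D hunts? hunts⇒arc public renaming (spanned to D′; spanned⊑ to D′⊑D)

  hunters-of-prey : ∀ {u a} → Hunts u (prey a) → u ≡ c a ⊎ u ≡ c (next a)
  hunters-of-prey (a′ , u-hunts , eq) with prey-injective eq
  ... | refl = u-hunts

  prey-of-hunter : ∀ {b y} → Hunts (c b) y → y ≡ prey b ⊎ y ≡ prey (prev b)
  prey-of-hunter (a , inj₁ e , refl) = inj₁ (cong prey (sym (c-injective e)))
  prey-of-hunter (a , inj₂ e , refl) =
    inj₂ (cong prey (sym (trans (cong prev (c-injective e)) (prev-next a))))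

  indeg-D′ : ∀ v → indeg D′ v ≡ 0 ⊎ indeg D′ v ≡ 2
  indeg-D′ v with any? (λ a → prey a ≟ v)
  ... | yes (a , refl) = inj₂ (countTrue-two (λ u → arc D′ u v) id (c a) (c (next a))
          (next≢ a ∘ sym ∘ c-injective)
          (R⇒arc-spanned (a , inj₁ refl , refl)) (R⇒arc-spanned (a , inj₂ refl , refl))
          (λ u → hunters-of-prey ∘ arc⇒R))
  ... | no not-prey = inj₁ (countTrue-none (λ u → arc D′ u v) id λ u h →
          not-prey (let (a , _ , e) = arc⇒R h in a , sym e))

  outdeg-D′ : ∀ v → outdeg D′ v ≡ 0 ⊎ outdeg D′ v ≡ 2
  outdeg-D′ v with any? (λ b → c b ≟ v)
  ... | yes (b , refl) = inj₂ (countTrue-two (arc D′ v) id (prey b) (prey (prev b))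
          (λ e → next≢ b (trans (cong next (prey-injective e)) (next-prev b)))
          (R⇒arc-spanned (b , inj₁ refl , refl))
          (R⇒arc-spanned (prev b , inj₂ (cong c (sym (next-prev b))) , refl))
          (λ y → prey-of-hunter ∘ arc⇒R))
  ... | no not-hunter = inj₁ (countTrue-none (arc D′ v) id λ y h → not-hunter (hunter (arc⇒R h)))
    where
    hunter : ∀ {y} → Hunts v y → ∃ λ b → c b ≡ v
    hunter (a , inj₁ e , _) = a , sym e
    hunter (a , inj₂ e , _) = next a , sym e

  D′-bar22 : Bar22 D′
  D′-bar22 v = indeg-D′ v , outdeg-D′ v

  Flank : Fin (suc k) → Rel (Fin (n D)) 0ℓ
  Flank a u v = (u ≡ c a × v ≡ c (next a)) ⊎ (u ≡ c (next a) × v ≡ c a)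

  flank-of-common-prey : ∀ {u v a} → u ≢ v → Hunts u (prey a) → Hunts v (prey a) → Flank a u v
  flank-of-common-prey u≢v hu hv with hunters-of-prey hu | hunters-of-prey hv
  ... | inj₁ refl | inj₁ refl = ⊥-elim (u≢v refl)
  ... | inj₁ refl | inj₂ refl = inj₁ (refl , refl)
  ... | inj₂ refl | inj₁ refl = inj₂ (refl , refl)
  ... | inj₂ refl | inj₂ refl = ⊥-elim (u≢v refl)

  common-prey-D′ : ∀ {u v z} → u ≢ v → Arc D′ u z → Arc D′ v z → ∃ λ a → z ≡ prey a × Flank a u v
  common-prey-D′ u≢v hu hv with arc⇒R hu
  ... | a , _ , refl = a , refl , flank-of-common-prey u≢v (arc⇒R hu) (arc⇒R hv)

  flank-unique : ∀ {a a′ u v} → Flank a u v → Flank a′ u v → a ≡ a′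
  flank-unique (inj₁ (refl , refl)) (inj₁ (e , _)) = c-injective e
  flank-unique (inj₁ (refl , refl)) (inj₂ (e , e′)) =
    ⊥-elim (next²≢ _ (trans (cong next (sym (c-injective e))) (c-injective e′)))
  flank-unique (inj₂ (refl , refl)) (inj₁ (e′ , e)) =
    ⊥-elim (next²≢ _ (trans (cong next (sym (c-injective e))) (c-injective e′)))
  flank-unique (inj₂ (refl , refl)) (inj₂ (_ , e)) = c-injective e

  common-prey-D′-unique : ∀ {u v z z′} → u ≢ v → Arc D′ u z → Arc D′ v z →
                          Arc D′ u z′ → Arc D′ v z′ → z ≡ z′
  common-prey-D′-unique u≢v hu hv hu′ hv′ with common-prey-D′ u≢v hu hv | common-prey-D′ u≢v hu′ hv′
  ... | _ , refl , flank | _ , refl , flank′ = cong prey (flank-unique flank flank′)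

  D′-irredundant : Irredundant D′
  D′-irredundant emb@(_ , f-injective , _) =
    case f-injective (common-prey-D′-unique (λ e → case f-injective e of λ ())
           (embedded-arc 0F 2F) (embedded-arc 1F 2F) (embedded-arc 0F 3F) (embedded-arc 1F 3F)) of λ ()
    where open Embedding D′ P22 emb

  competition-D′⇒consecutive : ∀ {u v} → CompEdge D′ u v →
                               ∃₂ λ a b → u ≡ c a × v ≡ c b × Consecutive a b
  competition-D′⇒consecutive (u≢v , _ , hu , hv) with common-prey-D′ u≢v hu hv
  ... | a , _ , inj₁ (eu , ev) = a , next a , eu , ev , inj₁ refl
  ... | a , _ , inj₂ (eu , ev) = next a , a , eu , ev , inj₂ refl

  competition-D′-triangle-free : ∀ {u v x} → CompEdge D′ u v → CompEdge D′ v x → CompEdge D′ u x → ⊥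
  competition-D′-triangle-free uv vx ux
    with competition-D′⇒consecutive uv | competition-D′⇒consecutive vx | competition-D′⇒consecutive ux
  ... | _ , _ , refl , refl , ab | _ , _ , ev , refl , bd | _ , _ , eu , ex , ad
    with c-injective ev | c-injective eu | c-injective ex
  ... | refl | refl | refl = consecutive-triangle-free ab bd ad

  D′-induces-no-triangle : ¬ InducesTriangle D′
  D′-induces-no-triangle (inj₁ emb) = competition-D′-triangle-free
    (embedded-competition 0F 1F 3F) (embedded-competition 1F 2F 4F) (embedded-competition 0F 2F 5F)
    where open Embedding D′ TriA emb
  D′-induces-no-triangle (inj₂ (inj₁ emb)) = competition-D′-triangle-free
    (embedded-competition 0F 1F 3F) (embedded-competition 1F 2F 3F) (embedded-competition 0F 2F 3F)
    where open Embedding D′ TriB emb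
  D′-induces-no-triangle (inj₂ (inj₂ (inj₁ emb))) = competition-D′-triangle-free
    (embedded-competition 0F 1F 3F) (embedded-competition 1F 2F 4F) (embedded-competition 0F 2F 1F)
    where open Embedding D′ TriC emb
  D′-induces-no-triangle (inj₂ (inj₂ (inj₂ (inj₁ emb)))) = competition-D′-triangle-free
    (embedded-competition 0F 1F 2F) (embedded-competition 1F 2F 0F) (embedded-competition 0F 2F 1F)
    where open Embedding D′ TriD emb
  D′-induces-no-triangle (inj₂ (inj₂ (inj₂ (inj₂ emb)))) = competition-D′-triangle-free
    (embedded-competition 0F 1F 2F) (embedded-competition 1F 3F 0F) (embedded-competition 0F 3F 1F)
    where open Embedding D′ TriE emb

  D′-has-arc : HasArc D′
  D′-has-arc = c zero , prey zero , R⇒arc-spanned (zero , inj₁ refl , refl)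

proposition2p10 : (i j : ℕ) → 1 ≤ i → 1 ≤ j → (D : Digraph) → IJDigraph i j D
    → ¬ (Σ Digraph λ D' → D' ⊑ D × Bar22 D' × Irredundant D' × ¬ InducesTriangle D' × HasArc D')
    → CompetitionGraphChordal D
proposition2p10 _ _ _ _ D _ no-forbidden-subdigraph (suc k) (s≤s k≥3) (c , c-injective , c-induced) =
  no-forbidden-subdigraph (D′ , D′⊑D , D′-bar22 , D′-irredundant , D′-induces-no-triangle , D′-has-arc)
  where open InducedCycle D k≥3 c c-injective c-induced
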